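{- Suppose that $\epsilon_3\le 1/4$. Then the values $\{\alpha_{eu}\}$ produced by the rounding algorithm described in the context satisfy: (1) $\alpha_{eu}\in\{0,1\}$ for every edge $e$ and endpoint $u$; (2) for every edge $e=uv$, $\alpha_{eu}+\alpha_{ev}\ge 1$; (3) for every vertex $u$, $\sum_{e\ni u}\alpha_{eu}\le(1+\epsilon_1)(1+\epsilon_2)(1+\epsilon_3)^{t}\tilde D+16$.
   Context: $G=(V,E)$ is a simple undirected graph with maximum degree $\Delta$; $\tilde D\ge1$ is an integer and $\epsilon_1,\epsilon_2,\epsilon_3\in(0,1)$. We are given values $\alpha'_{eu}\ge0$ (for each edge $e$ and endpoint $u$) with $\alpha'_{eu}+\alpha'_{ev}\ge1$ for every edge $e=uv$ and $\sum_{e\ni u}\alpha'_{eu}\le(1+\epsilon_1)\tilde D$ for every vertex $u$, each having a finite binary expansion with at most $B$ bits after the binary point. Let $t=\min(B,\lceil\log_2(\Delta/\epsilon_2)\rceil)$ and set $\alpha^{(0)}_{eu}=\lceil 2^t\alpha'_{eu}\rceil/2^t$. For a value $\alpha$, $\alpha(k)$ denotes its $(t-k+1)$-th bit after the binary point. For $k=1,\dots,t$: for every edge $e=uv$ with $\alpha^{(k-1)}_{eu}(k)=0$ or $\alpha^{(k-1)}_{ev}(k)=0$, set $\alpha^{(k)}_{eu}$ (resp. $\alpha^{(k)}_{ev}$) equal to $\alpha^{(k-1)}_{eu}$ (resp. $\alpha^{(k-1)}_{ev}$) with its bit $k$ set to $0$; let $G_k=(V,E_k)$ with $E_k$ the set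 of edges $e=uv$ with $\alpha^{(k-1)}_{eu}(k)=\alpha^{(k-1)}_{ev}(k)=1$, and let $\deg_k(u)$, $\mathrm{outdeg}_k(u)$, $\mathrm{indeg}_k(u)$ be degree, outdegree, indegree in $G_k$; compute any orientation of $E_k$ with $|\mathrm{outdeg}_k(u)-\mathrm{indeg}_k(u)|\le\epsilon_3\deg_k(u)+12$ for every vertex $u$; for every $e=uv\in E_k$ oriented from $u$ to $v$, set $\alpha^{(k)}_{eu}=\alpha^{(k-1)}_{eu}+2^{ -(t-k+1)}$ and $\alpha^{(k)}_{ev}=\alpha^{(k-1)}_{ev}-2^{ -(t-k+1)}$. Finally output $\alpha_{eu}=\min(\alpha^{(t)}_{eu},1)$ for every edge $e$ and endpoint $u$.
   Formalization: The parameters ε₁, ε₂ and ε₃ range only over the rationals in (0,1). -}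

module Defs where

open import Data.Bool using (Bool; true; false; _∧_; if_then_else_)
open import Data.Nat as ℕ using (ℕ; zero; suc; _∸_; _^_; _⊔_; _⊓_)
open import Data.Nat.DivMod using (_/_; _%_)
open import Data.Nat.Properties using (m^n≢0)
open import Data.Fin using (Fin)
open import Data.Integer using (+_)
open import Data.Rational as ℚ using (ℚ; 0ℚ; 1ℚ)
open import Data.Product using (_×_)
open import Data.Sum using (_⊎_)
open import Relation.Binary.PropositionalEquality using (_≡_)

sumℕ : ∀ {n} → (Fin n → ℕ) → ℕ
sumℕ {zero}  f = 0
sumℕ {suc n} f = f Fin.zero ℕ.+ sumℕ (λ i → f (Fin.suc i))
  where import Data.Fin as Fin

sumℚ : ∀ {n} → (Fin n → ℚ) → ℚ
sumℚ {zero}  f = 0ℚ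
sumℚ {suc n} f = f Fin.zero ℚ.+ sumℚ (λ i → f (Fin.suc i))
  where import Data.Fin as Fin

maxℕ : ∀ {n} → (Fin n → ℕ) → ℕ
maxℕ {zero}  f = 0
maxℕ {suc n} f = f Fin.zero ⊔ maxℕ (λ i → f (Fin.suc i))
  where import Data.Fin as Fin

_^ℚ_ : ℚ → ℕ → ℚ
p ^ℚ zero  = 1ℚ
p ^ℚ suc k = p ℚ.* (p ^ℚ k)

ℕtoℚ : ℕ → ℚ
ℕtoℚ m = (+ m) ℚ./ 1

-- An edge e = uv is an
-- unordered pair with Adj u v ≡ true; a quantity x_{eu} attached to the
-- edge e = uv and its endpoint u is represented as  x u v.

record SimpleGraph (n : ℕ) : Set where
  field
    Adj   : Fin n → Fin n → Bool
    sym   : ∀ u v → Adj u v ≡ Adj v u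
    irrefl : ∀ u → Adj u u ≡ false

open SimpleGraph public

b2n : Bool → ℕ
b2n true  = 1
b2n false = 0

deg : ∀ {n} → SimpleGraph n → Fin n → ℕ
deg G u = sumℕ (λ v → b2n (Adj G u v))

maxDeg : ∀ {n} → SimpleGraph n → ℕ
maxDeg G = maxℕ (deg G)

sumAt : ∀ {n} → SimpleGraph n → (Fin n → Fin n → ℚ) → Fin n → ℚ
sumAt G x u = sumℚ (λ v → if Adj G u v then x u v else 0ℚ)

dyadic : ℕ → ℕ → ℚ
dyadic s a = (+ a) ℚ./ (2 ^ s)
  where instance _ = m^n≢0 2 s

ceilDiv2^ : ℕ → ℕ → ℕ
ceilDiv2^ s a = ((a ℕ.+ (2 ^ s ∸ 1)) / (2 ^ s))
  where instance _ = m^n≢0 2 s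

bitAt : ℕ → ℕ → ℕ
bitAt i m = (m / (2 ^ i)) % 2
  where instance _ = m^n≢0 2 i

-- All intermediate values α^{(k)}_{eu} have at most t bits after the
-- binary point; we store the numerators A^{(k)} u v = 2^t · α^{(k)}_{eu}.
-- Bit k of α (its (t-k+1)-th bit after the binary point, of weight
-- 2^{-(t-k+1)}) is bit (k-1) of A, of weight 2^(k-1).

-- initial values: A^{(0)} u v = ⌈2^t α'_{eu}⌉, where α'_{eu} = a u v / 2^B
-- and t ≤ B
initA : (B t : ℕ) → ∀ {n} → (Fin n → Fin n → ℕ) → Fin n → Fin n → ℕ
initA B t a u v = ceilDiv2^ (B ∸ t) (a u v)

-- the edge set E_k of G_k, computed from A = A^{(k-1)}  (k ≥ 1)
Ek : ∀ {n} → SimpleGraph n → ℕ → (Fin n → Fin n → ℕ) → Fin n → Fin n → Bool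
Ek G k A u v = Adj G u v ∧ (bitIs1 (A u v) ∧ bitIs1 (A v u))
  where
  bitIs1 : ℕ → Bool
  bitIs1 m with bitAt (k ∸ 1) m
  ... | 1 = true
  ... | _ = false

-- one round k ≥ 1, given A = A^{(k-1)} and an orientation o of E_k
-- (o u v ≡ true meaning that the edge uv is oriented from u to v)
roundStep : ∀ {n} → SimpleGraph n → ℕ → (Fin n → Fin n → Bool)
          → (Fin n → Fin n → ℕ) → Fin n → Fin n → ℕ
roundStep G k o A u v =
  if Ek G k A u v
  then (if o u v then A u v ℕ.+ 2 ^ (k ∸ 1) else A u v ∸ 2 ^ (k ∸ 1))
  else A u v ∸ bitAt (k ∸ 1) (A u v) ℕ.* 2 ^ (k ∸ 1)

runA : (B t : ℕ) → ∀ {n} → SimpleGraph n → (Fin n → Fin n → ℕ)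
     → (ℕ → Fin n → Fin n → Bool) → ℕ → Fin n → Fin n → ℕ
runA B t G a orient zero    = initA B t a
runA B t G a orient (suc k) = roundStep G (suc k) (orient (suc k)) (runA B t G a orient k)

degE : ∀ {n} → (Fin n → Fin n → Bool) → Fin n → ℕ
degE E u = sumℕ (λ v → b2n (E u v))

outdeg : ∀ {n} → (Fin n → Fin n → Bool) → (Fin n → Fin n → Bool) → Fin n → ℕ
outdeg E o u = sumℕ (λ v → b2n (E u v ∧ o u v))

indeg : ∀ {n} → (Fin n → Fin n → Bool) → (Fin n → Fin n → Bool) → Fin n → ℕ
indeg E o u = sumℕ (λ v → b2n (E u v ∧ o v u))

IsOrientation : ∀ {n} → (Fin n → Fin n → Bool) → (Fin n → Fin n → Bool) → Set
IsOrientation E o = ∀ u v → E u v ≡ true → (o u v ≡ true × o v u ≡ false)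
                                          ⊎ (o u v ≡ false × o v u ≡ true)

Balanced : ∀ {n} → ℚ → (Fin n → Fin n → Bool) → (Fin n → Fin n → Bool) → Set
Balanced ε₃ E o = ∀ u →
  ℚ.∣ ℕtoℚ (outdeg E o u) ℚ.- ℕtoℚ (indeg E o u) ∣
    ℚ.≤ ε₃ ℚ.* ℕtoℚ (degE E u) ℚ.+ ℕtoℚ 12

output : (B t : ℕ) → ∀ {n} → SimpleGraph n → (Fin n → Fin n → ℕ)
       → (ℕ → Fin n → Fin n → Bool) → Fin n → Fin n → ℚ
output B t G a orient u v = dyadic t (runA B t G a orient t u v) ℚ.⊓ 1ℚ

-- Multiplied by 2^t, all values are natural numbers A_k. Round k clears bit k − 1 of every
-- value and, on each edge of G_k (both bits set), moves that bit to the tail of the edge, so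
-- 2^k divides A_k; hence α^{(t)} is an integer and α ∈ {0, 1}. An edge of G_k keeps its sum,
-- any other edge loses at most 2^{k−1}, which cannot push a multiple of 2^k below 2^t: the
-- edges stay covered. At a vertex, round k changes the load by 2^{k−1} (out − in) ≤
-- ε₃ 2^{k−1} deg_k + 12 · 2^{k−1} ≤ ε₃ load + 12 · 2^{k−1}, since each edge of G_k carries at
-- least 2^{k−1}. Iterating gives (1 + ε₃)^t times the initial load plus 16 · 2^t, and the
-- initial rounding up to t bits costs at most deg u ≤ ε₂ 2^t.

module Submission where

open import Defs
open import Data.Bool using (Bool; true)
open import Data.Nat as ℕ using (ℕ; _∸_; _⊓_)
open import Data.Fin using (Fin)
open import Data.Integer using (+_)
open import Data.Rational as ℚ using (ℚ; 0ℚ; 1ℚ)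
open import Data.Product using (_×_)
open import Data.Sum using (_⊎_)
open import Relation.Binary.PropositionalEquality using (_≡_)

open import Data.Bool using (false; T; _∧_; if_then_else_)
open import Data.Bool.Properties using (∧-comm; ∧-conicalˡ; ∧-conicalʳ)
import Data.Fin as Fin using (zero; suc)
open import Data.Nat using (zero; suc)
open import Data.Nat.Divisibility using (_∣_; divides; 1∣_)
import Data.Nat.Properties as ℕ
import Data.Rational.Properties as ℚ
open import Data.Product using (∃-syntax; _,_; proj₁; proj₂)
open import Data.Sum using (inj₁; inj₂; [_,_]′)
open import Function using (_∘_)
open import Relation.Binary.PropositionalEquality
  using (refl; trans; cong; cong₂; subst; subst₂; module ≡-Reasoning)
import Relation.Binary.PropositionalEquality as ≡

-- Arithmetic of numerators and of a single round

module _ where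
  open import Data.Nat
  open import Data.Nat.Properties
  open import Data.Nat.DivMod
  open import Data.Nat.Tactic.RingSolver using (solve-∀)

  sumℕ-mono-≤ : ∀ {n} (f g : Fin n → ℕ) → (∀ i → f i ≤ g i) → sumℕ f ≤ sumℕ g
  sumℕ-mono-≤ {zero}  f g f≤g = ≤-refl
  sumℕ-mono-≤ {suc n} f g f≤g =
    +-mono-≤ (f≤g Fin.zero) (sumℕ-mono-≤ (f ∘ Fin.suc) (g ∘ Fin.suc) (f≤g ∘ Fin.suc))

  sumℕ-cong : ∀ {n} {f g : Fin n → ℕ} → (∀ i → f i ≡ g i) → sumℕ f ≡ sumℕ g
  sumℕ-cong {zero}  f≡g = refl
  sumℕ-cong {suc n} f≡g = cong₂ _+_ (f≡g Fin.zero) (sumℕ-cong (f≡g ∘ Fin.suc))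

  sumℕ-*ˡ : ∀ {n} c (f : Fin n → ℕ) → sumℕ (λ i → c * f i) ≡ c * sumℕ f
  sumℕ-*ˡ {zero}  c f = ≡.sym (*-zeroʳ c)
  sumℕ-*ˡ {suc n} c f =
    trans (cong (_+_ (c * f Fin.zero)) (sumℕ-*ˡ c (f ∘ Fin.suc))) (≡.sym (*-distribˡ-+ c _ _))

  sumℕ-+-*ˡ : ∀ {n} c (f g : Fin n → ℕ) →
              sumℕ (λ i → f i + c * g i) ≡ sumℕ f + c * sumℕ g
  sumℕ-+-*ˡ {zero}  c f g = ≡.sym (*-zeroʳ c)
  sumℕ-+-*ˡ {suc n} c f g =
    trans (cong (_+_ (f Fin.zero + c * g Fin.zero)) (sumℕ-+-*ˡ c (f ∘ Fin.suc) (g ∘ Fin.suc)))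
          (interchange (f Fin.zero) (g Fin.zero) (sumℕ (f ∘ Fin.suc)) (sumℕ (g ∘ Fin.suc)) c)
    where
    interchange : ∀ x y X Y c → x + c * y + (X + c * Y) ≡ x + X + c * (y + Y)
    interchange = solve-∀

  maxℕ-upper : ∀ {n} (f : Fin n → ℕ) i → f i ≤ maxℕ f
  maxℕ-upper {suc n} f Fin.zero    = m≤m⊔n _ _
  maxℕ-upper {suc n} f (Fin.suc i) = ≤-trans (maxℕ-upper (f ∘ Fin.suc) i) (m≤n⊔m (f Fin.zero) _)

  ceilDiv2^-lower : ∀ s x → x ≤ ceilDiv2^ s x * 2 ^ s
  ceilDiv2^-lower s x = +-cancelʳ-≤ (d ∸ 1) x (m / d * d) (begin
    x + (d ∸ 1)           ≡⟨ m≡m%n+[m/n]*n m d ⟩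
    m % d + m / d * d     ≤⟨ +-monoˡ-≤ (m / d * d) (≤-pred (≤-trans (m%n<n m d) (≤-reflexive (≡.sym (suc-pred d))))) ⟩
    d ∸ 1 + m / d * d     ≡⟨ +-comm (d ∸ 1) _ ⟩
    m / d * d + (d ∸ 1)   ∎)
    where
    open ≤-Reasoning
    d = 2 ^ s
    instance _ = m^n≢0 2 s
    m = x + (d ∸ 1)

  ceilDiv2^-upper : ∀ s x → ceilDiv2^ s x * 2 ^ s ≤ x + 2 ^ s
  ceilDiv2^-upper s x = ≤-trans (m/n*n≤m (x + (2 ^ s ∸ 1)) (2 ^ s)) (+-monoʳ-≤ x (m∸n≤m (2 ^ s) 1))
    where instance _ = m^n≢0 2 s

  ceilDiv2^-zero : ∀ x → ceilDiv2^ 0 x ≡ x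
  ceilDiv2^-zero x = trans (n/1≡n (x + 0)) (+-identityʳ x)

  bitAt-*2^ : ∀ j m → bitAt j (m * 2 ^ j) ≡ m % 2
  bitAt-*2^ j m = cong (_% 2) (m*n/n≡m m (2 ^ j) {{m^n≢0 2 j}})

  bitAt≤1 : ∀ j x → bitAt j x ≤ 1
  bitAt≤1 j x = ≤-pred (m%n<n (x / 2 ^ j) 2)
    where instance _ = m^n≢0 2 j

  bits≤1 : ∀ {r s} → r ≤ 1 → s ≤ 1 → ((r ≡ᵇ 1) ∧ (s ≡ᵇ 1)) ≡ false → r + s ≤ 1
  bits≤1 {0}                   _        s≤1      _  = s≤1
  bits≤1 {1}           {0}     _        _        _  = ≤-refl
  bits≤1 {1}           {1}     _        _        ()
  bits≤1 {1}           {suc (suc _)} _  (s≤s ()) _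
  bits≤1 {suc (suc _)}         (s≤s ()) _        _

  bitSplit : ∀ j x → 2 ^ j ∣ x → ∃[ q ] x ≡ (bitAt j x + q * 2) * 2 ^ j
  bitSplit j _ (divides m refl) = m / 2 , (begin
    m * 2 ^ j                                  ≡⟨ cong (_* 2 ^ j) (m≡m%n+[m/n]*n m 2) ⟩
    (m % 2 + m / 2 * 2) * 2 ^ j                ≡⟨ cong (λ b → (b + m / 2 * 2) * 2 ^ j) (bitAt-*2^ j m) ⟨
    (bitAt j (m * 2 ^ j) + m / 2 * 2) * 2 ^ j  ∎)
    where open ≡-Reasoning

  oddSplit : ∀ j q {x} → bitAt j x ≡ 1 →
             x ≡ (bitAt j x + q * 2) * 2 ^ j → x ≡ (1 + q * 2) * 2 ^ j
  oddSplit j q {x} bit≡1 = subst (λ b → x ≡ (b + q * 2) * 2 ^ j) bit≡1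

  [r+q2]w≡rw+q2w : ∀ r q w → (r + q * 2) * w ≡ r * w + (q + 0) * (2 * w)
  [r+q2]w≡rw+q2w = solve-∀

  [r+q2]w∸rw≡q2w : ∀ r q w → (r + q * 2) * w ∸ r * w ≡ (q + 0) * (2 * w)
  [r+q2]w∸rw≡q2w r q w = trans (cong (_∸ r * w) ([r+q2]w≡rw+q2w r q w)) (m+n∸m≡n (r * w) _)

  [1+q2]w∸w≡q2w : ∀ q w → (1 + q * 2) * w ∸ w ≡ (q + 0) * (2 * w)
  [1+q2]w∸w≡q2w q w = trans (cong ((1 + q * 2) * w ∸_) (≡.sym (*-identityˡ w))) ([r+q2]w∸rw≡q2w 1 q w)

  [1+q2]w+w≡[q+1]2w : ∀ q w → (1 + q * 2) * w + w ≡ (q + 1) * (2 * w)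
  [1+q2]w+w≡[q+1]2w = solve-∀

  q2w≤[r+q2]w : ∀ r q w → (q + 0) * (2 * w) ≤ (r + q * 2) * w
  q2w≤[r+q2]w r q w = subst ((q + 0) * (2 * w) ≤_) (≡.sym ([r+q2]w≡rw+q2w r q w)) (m≤n+m _ (r * w))

  Oriented : Bool → Bool → Set
  Oriented x y = (x ≡ true × y ≡ false) ⊎ (x ≡ false × y ≡ true)

  oriented-pair-sum : ∀ q p w {x y} → Oriented x y →
    (q + b2n x) * (2 * w) + (p + b2n y) * (2 * w) ≡ (1 + q * 2) * w + (1 + p * 2) * w
  oriented-pair-sum q p w (inj₁ (refl , refl)) = out q p w
    where
    out : ∀ q p w → (q + 1) * (2 * w) + (p + 0) * (2 * w) ≡ (1 + q * 2) * w + (1 + p * 2) * w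
    out = solve-∀
  oriented-pair-sum q p w (inj₂ (refl , refl)) = into q p w
    where
    into : ∀ q p w → (q + 0) * (2 * w) + (p + 1) * (2 * w) ≡ (1 + q * 2) * w + (1 + p * 2) * w
    into = solve-∀

  oriented-move : ∀ q w {x y} → Oriented x y →
    (q + b2n x) * (2 * w) + w * b2n y ≡ (1 + q * 2) * w + w * b2n x
  oriented-move q w (inj₁ (refl , refl)) = out q w
    where
    out : ∀ q w → (q + 1) * (2 * w) + w * 0 ≡ (1 + q * 2) * w + w * 1
    out = solve-∀
  oriented-move q w (inj₂ (refl , refl)) = into q w
    where
    into : ∀ q w → (q + 0) * (2 * w) + w * 1 ≡ (1 + q * 2) * w + w * 0
    into = solve-∀

  2^t≤[1+N2]2^j⇒2^t≤N2^[1+j] : ∀ {t j} N → j < t →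
    2 ^ t ≤ (1 + N * 2) * 2 ^ j → 2 ^ t ≤ N * 2 ^ suc j
  2^t≤[1+N2]2^j⇒2^t≤N2^[1+j] {t} {j} N j<t 2^t≤ = begin
    2 ^ t          ≡⟨ 2^t≡K2^[1+j] ⟩
    K * 2 ^ suc j  ≤⟨ *-monoˡ-≤ (2 ^ suc j) K≤N ⟩
    N * 2 ^ suc j  ∎
    where
    open ≤-Reasoning
    K = 2 ^ (t ∸ suc j)
    2^t≡K2^[1+j] : 2 ^ t ≡ K * 2 ^ suc j
    2^t≡K2^[1+j] = trans (cong (2 ^_) (≡.sym (m∸n+n≡m j<t))) (^-distribˡ-+-* 2 (t ∸ suc j) (suc j))
    K2≤1+N2 : K * 2 ≤ 1 + N * 2
    K2≤1+N2 = *-cancelʳ-≤ (K * 2) (1 + N * 2) (2 ^ j) {{m^n≢0 2 j}}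
      (subst (_≤ _) (trans 2^t≡K2^[1+j] (≡.sym (*-assoc K 2 (2 ^ j)))) 2^t≤)
    K≤N : K ≤ N
    K≤N = ≤-pred (*-cancelʳ-< 2 K (suc N) (s≤s K2≤1+N2))

  module _ {n} (G : SimpleGraph n) (j : ℕ) (A : Fin n → Fin n → ℕ) where

    Ek-unfold : ∀ u v →
      Ek G (suc j) A u v ≡ Adj G u v ∧ ((bitAt j (A u v) ≡ᵇ 1) ∧ (bitAt j (A v u) ≡ᵇ 1))
    Ek-unfold u v with bitAt j (A u v)
    ... | 0           = refl
    ... | suc (suc _) = refl
    ... | 1 with bitAt j (A v u)
    ...   | 0           = refl
    ...   | 1           = refl
    ...   | suc (suc _) = refl

    Ek-sym : ∀ u v → Ek G (suc j) A u v ≡ Ek G (suc j) A v u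
    Ek-sym u v = begin
      Ek G (suc j) A u v
        ≡⟨ Ek-unfold u v ⟩
      Adj G u v ∧ ((bitAt j (A u v) ≡ᵇ 1) ∧ (bitAt j (A v u) ≡ᵇ 1))
        ≡⟨ cong₂ _∧_ (SimpleGraph.sym G u v) (∧-comm (bitAt j (A u v) ≡ᵇ 1) _) ⟩
      Adj G v u ∧ ((bitAt j (A v u) ≡ᵇ 1) ∧ (bitAt j (A u v) ≡ᵇ 1))
        ≡⟨ Ek-unfold v u ⟨
      Ek G (suc j) A v u
        ∎
      where open ≡-Reasoning

    Ek⇒Adj : ∀ u v → Ek G (suc j) A u v ≡ true → Adj G u v ≡ true
    Ek⇒Adj u v e = ∧-conicalˡ (Adj G u v) _ (trans (≡.sym (Ek-unfold u v)) e)

    Ek⇒bit≡1 : ∀ u v → Ek G (suc j) A u v ≡ true → bitAt j (A u v) ≡ 1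
    Ek⇒bit≡1 u v e = ≡ᵇ⇒≡ _ 1 (subst T (≡.sym bit≡ᵇ1) _)
      where
      bit≡ᵇ1 : (bitAt j (A u v) ≡ᵇ 1) ≡ true
      bit≡ᵇ1 = ∧-conicalˡ (bitAt j (A u v) ≡ᵇ 1) _ (∧-conicalʳ (Adj G u v) _ (trans (≡.sym (Ek-unfold u v)) e))

    ¬Adj⇒¬Ek : ∀ u v → Adj G u v ≡ false → Ek G (suc j) A u v ≡ false
    ¬Adj⇒¬Ek u v ¬adj = trans (Ek-unfold u v) (cong (_∧ _) ¬adj)

    ¬Ek⇒bits≤1 : ∀ u v → Adj G u v ≡ true → Ek G (suc j) A u v ≡ false →
                 bitAt j (A u v) + bitAt j (A v u) ≤ 1
    ¬Ek⇒bits≤1 u v adj ¬e = bits≤1 (bitAt≤1 j _) (bitAt≤1 j _)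
      (subst (λ b → b ∧ _ ≡ false) adj (trans (≡.sym (Ek-unfold u v)) ¬e))

    roundStep-split : ∀ o u v q → A u v ≡ (bitAt j (A u v) + q * 2) * 2 ^ j →
      roundStep G (suc j) o A u v ≡ (q + b2n (Ek G (suc j) A u v ∧ o u v)) * 2 ^ suc j
    roundStep-split o u v q split with Ek G (suc j) A u v in e | o u v
    ... | true  | true  =
      trans (cong (_+ 2 ^ j) (oddSplit j q (Ek⇒bit≡1 u v e) split)) ([1+q2]w+w≡[q+1]2w q (2 ^ j))
    ... | true  | false =
      trans (cong (_∸ 2 ^ j) (oddSplit j q (Ek⇒bit≡1 u v e) split)) ([1+q2]w∸w≡q2w q (2 ^ j))
    ... | false | _     =
      trans (cong (_∸ bitAt j (A u v) * 2 ^ j) split) ([r+q2]w∸rw≡q2w (bitAt j (A u v)) q (2 ^ j))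

-- The run: divisibility, edge sums and vertex loads

module Run {n} (G : SimpleGraph n) (B t : ℕ) (a : Fin n → Fin n → ℕ)
           (orient : ℕ → Fin n → Fin n → Bool) where
  open import Data.Nat
  open import Data.Nat.Properties
  open import Data.Nat.Tactic.RingSolver using (solve-∀)

  A : ℕ → Fin n → Fin n → ℕ
  A = runA B t G a orient

  -- Round j + 1 acts on bit j of the numerators, with edge set E j and orientation o j.
  E : ℕ → Fin n → Fin n → Bool
  E j = Ek G (suc j) (A j)

  o : ℕ → Fin n → Fin n → Bool
  o j = orient (suc j)

  2^k∣A : ∀ k u v → 2 ^ k ∣ A k u v
  2^k∣A zero    u v = 1∣ _
  2^k∣A (suc j) u v with bitSplit j (A j u v) (2^k∣A j u v)
  ... | q , split = divides (q + b2n (E j u v ∧ o j u v)) (roundStep-split G j (A j) (o j) u v q split)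

  high : ℕ → Fin n → Fin n → ℕ
  high j u v = proj₁ (bitSplit j (A j u v) (2^k∣A j u v))

  A-split : ∀ j u v → A j u v ≡ (bitAt j (A j u v) + high j u v * 2) * 2 ^ j
  A-split j u v = proj₂ (bitSplit j (A j u v) (2^k∣A j u v))

  A-step : ∀ j u v {x} → E j u v ≡ x →
           A (suc j) u v ≡ (high j u v + b2n (x ∧ o j u v)) * 2 ^ suc j
  A-step j u v refl = roundStep-split G j (A j) (o j) u v (high j u v) (A-split j u v)

  E-odd : ∀ j u v → E j u v ≡ true → A j u v ≡ (1 + high j u v * 2) * 2 ^ j
  E-odd j u v e = oddSplit j (high j u v) (Ek⇒bit≡1 G j (A j) u v e) (A-split j u v)

  E-swap : ∀ j u v {x} → E j u v ≡ x → E j v u ≡ x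
  E-swap j u v = trans (≡.sym (Ek-sym G j (A j) u v))

  E-pair-sum : ∀ j u v → IsOrientation (E j) (o j) → E j u v ≡ true →
               A (suc j) u v + A (suc j) v u ≡ A j u v + A j v u
  E-pair-sum j u v ori e = begin
    A (suc j) u v + A (suc j) v u
      ≡⟨ cong₂ _+_ (A-step j u v e) (A-step j v u (E-swap j u v e)) ⟩
    (q + b2n (o j u v)) * 2 ^ suc j + (p + b2n (o j v u)) * 2 ^ suc j
      ≡⟨ oriented-pair-sum q p (2 ^ j) (ori u v e) ⟩
    (1 + q * 2) * 2 ^ j + (1 + p * 2) * 2 ^ j
      ≡⟨ cong₂ _+_ (E-odd j u v e) (E-odd j v u (E-swap j u v e)) ⟨
    A j u v + A j v u ∎
    where
    open ≡-Reasoning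
    q = high j u v
    p = high j v u

  ¬E-pair-sum : ∀ j u v → E j u v ≡ false →
                A (suc j) u v + A (suc j) v u ≡ (high j u v + high j v u) * 2 ^ suc j
  ¬E-pair-sum j u v ¬e = trans (cong₂ _+_ (A-step j u v ¬e) (A-step j v u (E-swap j u v ¬e)))
                               (regroup (high j u v) (high j v u) (2 ^ suc j))
    where
    regroup : ∀ q p w → (q + 0) * w + (p + 0) * w ≡ (q + p) * w
    regroup = solve-∀

  ¬E-pair-bound : ∀ j u v → Adj G u v ≡ true → E j u v ≡ false →
                  A j u v + A j v u ≤ (1 + (high j u v + high j v u) * 2) * 2 ^ j
  ¬E-pair-bound j u v adj ¬e = begin
    A j u v + A j v u                  ≡⟨ cong₂ _+_ (A-split j u v) (A-split j v u) ⟩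
    (r + q * 2) * w + (s + p * 2) * w  ≡⟨ regroup r s q p w ⟩
    (r + s + (q + p) * 2) * w          ≤⟨ *-monoˡ-≤ w (+-monoˡ-≤ _ (¬Ek⇒bits≤1 G j (A j) u v adj ¬e)) ⟩
    (1 + (q + p) * 2) * w              ∎
    where
    open ≤-Reasoning
    r = bitAt j (A j u v)
    s = bitAt j (A j v u)
    q = high j u v
    p = high j v u
    w = 2 ^ j
    regroup : ∀ r s q p w → (r + q * 2) * w + (s + p * 2) * w ≡ (r + s + (q + p) * 2) * w
    regroup = solve-∀

  edge-sum-init : t ≤ B → ∀ u v → 2 ^ B ≤ a u v + a v u → 2 ^ t ≤ A 0 u v + A 0 v u
  edge-sum-init t≤B u v 2^B≤ = *-cancelʳ-≤ (2 ^ t) _ (2 ^ s) {{m^n≢0 2 s}} (begin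
    2 ^ t * 2 ^ s                      ≡⟨ ^-distribˡ-+-* 2 t s ⟨
    2 ^ (t + s)                        ≡⟨ cong (2 ^_) (m+[n∸m]≡n t≤B) ⟩
    2 ^ B                              ≤⟨ 2^B≤ ⟩
    a u v + a v u                      ≤⟨ +-mono-≤ (ceilDiv2^-lower s (a u v)) (ceilDiv2^-lower s (a v u)) ⟩
    A 0 u v * 2 ^ s + A 0 v u * 2 ^ s  ≡⟨ *-distribʳ-+ (2 ^ s) (A 0 u v) (A 0 v u) ⟨
    (A 0 u v + A 0 v u) * 2 ^ s        ∎)
    where
    open ≤-Reasoning
    s = B ∸ t

  -- An edge outside E j loses its two bits j, at most 2^j in total; what remains is a
  -- multiple of 2^(j+1), hence still at least 2^t.
  edge-sum-step : ∀ j → j < t → IsOrientation (E j) (o j) → ∀ u v → Adj G u v ≡ true →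
                  2 ^ t ≤ A j u v + A j v u → 2 ^ t ≤ A (suc j) u v + A (suc j) v u
  edge-sum-step j j<t ori u v adj 2^t≤ = by-cases (E j u v) refl
    where
    by-cases : ∀ x → E j u v ≡ x → 2 ^ t ≤ A (suc j) u v + A (suc j) v u
    by-cases true  e  = ≤-trans 2^t≤ (≤-reflexive (≡.sym (E-pair-sum j u v ori e)))
    by-cases false ¬e = subst (2 ^ t ≤_) (≡.sym (¬E-pair-sum j u v ¬e))
      (2^t≤[1+N2]2^j⇒2^t≤N2^[1+j] (high j u v + high j v u) j<t
        (≤-trans 2^t≤ (¬E-pair-bound j u v adj ¬e)))

  edge-sum : t ≤ B → (∀ j → j < t → IsOrientation (E j) (o j)) →
             (∀ u v → Adj G u v ≡ true → 2 ^ B ≤ a u v + a v u) →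
             ∀ k → k ≤ t → ∀ u v → Adj G u v ≡ true → 2 ^ t ≤ A k u v + A k v u
  edge-sum t≤B ori cover zero    _   u v adj = edge-sum-init t≤B u v (cover u v adj)
  edge-sum t≤B ori cover (suc j) j<t u v adj =
    edge-sum-step j j<t (ori j j<t) u v adj (edge-sum t≤B ori cover j (<⇒≤ j<t) u v adj)

  load : ℕ → Fin n → ℕ
  load k u = sumℕ (λ v → if Adj G u v then A k u v else 0)

  round-moves : ∀ j → IsOrientation (E j) (o j) → ∀ u v {x} → E j u v ≡ x →
    A (suc j) u v + 2 ^ j * b2n (x ∧ o j v u) ≤ A j u v + 2 ^ j * b2n (x ∧ o j u v)
  round-moves j ori u v {true}  e = ≤-reflexive (begin
    A (suc j) u v + 2 ^ j * b2n (o j v u)                 ≡⟨ cong (_+ 2 ^ j * b2n (o j v u)) (A-step j u v e) ⟩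
    (high j u v + b2n (o j u v)) * 2 ^ suc j + 2 ^ j * b2n (o j v u)
                                                          ≡⟨ oriented-move (high j u v) (2 ^ j) (ori u v e) ⟩
    (1 + high j u v * 2) * 2 ^ j + 2 ^ j * b2n (o j u v)  ≡⟨ cong (_+ 2 ^ j * b2n (o j u v)) (E-odd j u v e) ⟨
    A j u v + 2 ^ j * b2n (o j u v)                       ∎)
    where open ≡-Reasoning
  round-moves j ori u v {false} e = +-monoˡ-≤ (2 ^ j * 0) (begin
    A (suc j) u v                                   ≡⟨ A-step j u v e ⟩
    (high j u v + 0) * 2 ^ suc j                    ≤⟨ q2w≤[r+q2]w (bitAt j (A j u v)) (high j u v) (2 ^ j) ⟩
    (bitAt j (A j u v) + high j u v * 2) * 2 ^ j    ≡⟨ A-split j u v ⟨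
    A j u v                                         ∎)
    where open ≤-Reasoning

  load-step : ∀ j → IsOrientation (E j) (o j) → ∀ u →
    load (suc j) u + 2 ^ j * indeg (E j) (o j) u ≤ load j u + 2 ^ j * outdeg (E j) (o j) u
  load-step j ori u = begin
    load (suc j) u + 2 ^ j * indeg (E j) (o j) u         ≡⟨ sumℕ-+-*ˡ {n} (2 ^ j) _ _ ⟨
    sumℕ (λ v → masked (A (suc j)) v + 2 ^ j * b2n (E j u v ∧ o j v u))
                                                         ≤⟨ sumℕ-mono-≤ {n} _ _ masked-moves ⟩
    sumℕ (λ v → masked (A j) v + 2 ^ j * b2n (E j u v ∧ o j u v))
                                                         ≡⟨ sumℕ-+-*ˡ {n} (2 ^ j) _ _ ⟩
    load j u + 2 ^ j * outdeg (E j) (o j) u              ∎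
    where
    open ≤-Reasoning
    masked : (Fin n → Fin n → ℕ) → Fin n → ℕ
    masked X v = if Adj G u v then X u v else 0
    masked-moves : ∀ v → masked (A (suc j)) v + 2 ^ j * b2n (E j u v ∧ o j v u)
                       ≤ masked (A j) v + 2 ^ j * b2n (E j u v ∧ o j u v)
    masked-moves v = by-cases (Adj G u v) refl
      where
      by-cases : ∀ b → Adj G u v ≡ b →
        (if b then A (suc j) u v else 0) + 2 ^ j * b2n (E j u v ∧ o j v u)
          ≤ (if b then A j u v else 0) + 2 ^ j * b2n (E j u v ∧ o j u v)
      by-cases true  _    = round-moves j ori u v refl
      by-cases false ¬adj rewrite ¬Adj⇒¬Ek G j (A j) u v ¬adj = ≤-refl

  2^j*degE≤load : ∀ j u → 2 ^ j * degE (E j) u ≤ load j u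
  2^j*degE≤load j u = begin
    2 ^ j * degE (E j) u                 ≡⟨ sumℕ-*ˡ {n} (2 ^ j) _ ⟨
    sumℕ (λ v → 2 ^ j * b2n (E j u v))   ≤⟨ sumℕ-mono-≤ {n} _ _ bound ⟩
    load j u                             ∎
    where
    open ≤-Reasoning
    bound : ∀ v → 2 ^ j * b2n (E j u v) ≤ (if Adj G u v then A j u v else 0)
    bound v = by-cases (E j u v) refl
      where
      by-cases : ∀ x → E j u v ≡ x → 2 ^ j * b2n x ≤ (if Adj G u v then A j u v else 0)
      by-cases false _ = subst (_≤ (if Adj G u v then A j u v else 0)) (≡.sym (*-zeroʳ (2 ^ j))) z≤n
      by-cases true  e = subst (λ b → 2 ^ j * 1 ≤ (if b then A j u v else 0))
        (≡.sym (Ek⇒Adj G j (A j) u v e))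
        (subst₂ _≤_ (≡.sym (*-identityʳ (2 ^ j))) (≡.sym (E-odd j u v e)) (m≤m+n (2 ^ j) _))

  inputLoad : Fin n → ℕ
  inputLoad u = sumℕ (λ v → if Adj G u v then a u v else 0)

  load₀≡inputLoad : t ≡ B → ∀ u → load 0 u ≡ inputLoad u
  load₀≡inputLoad t≡B u = sumℕ-cong λ v → cong (if Adj G u v then_else 0) (A₀≡a v)
    where
    A₀≡a : ∀ v → A 0 u v ≡ a u v
    A₀≡a v = trans (cong (λ s → ceilDiv2^ s (a u v)) (trans (cong (B ∸_) t≡B) (n∸n≡0 B)))
                   (ceilDiv2^-zero (a u v))

  load₀-bound : ∀ u → 2 ^ (B ∸ t) * load 0 u ≤ inputLoad u + 2 ^ (B ∸ t) * deg G u
  load₀-bound u = begin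
    d * load 0 u                                           ≡⟨ sumℕ-*ˡ {n} d _ ⟨
    sumℕ (λ v → d * (if Adj G u v then A 0 u v else 0))   ≤⟨ sumℕ-mono-≤ {n} _ _ bound ⟩
    sumℕ (λ v → (if Adj G u v then a u v else 0) + d * b2n (Adj G u v))
                                                           ≡⟨ sumℕ-+-*ˡ {n} d _ _ ⟩
    inputLoad u + d * deg G u                              ∎
    where
    open ≤-Reasoning
    d = 2 ^ (B ∸ t)
    bound : ∀ v → d * (if Adj G u v then A 0 u v else 0)
                ≤ (if Adj G u v then a u v else 0) + d * b2n (Adj G u v)
    bound v with Adj G u v
    ... | true  = subst₂ _≤_ (*-comm (A 0 u v) d) (cong (_+_ (a u v)) (≡.sym (*-identityʳ d)))
                    (ceilDiv2^-upper (B ∸ t) (a u v))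
    ... | false = ≤-refl

-- Rational bounds

module _ where
  open import Data.Rational
  open import Data.Rational.Properties
  open import Data.Rational.Solver using (module +-*-Solver)
  open +-*-Solver
  import Data.Rational.Unnormalised as ℚᵘ
  import Data.Rational.Unnormalised.Properties as ℚᵘ
  import Data.Integer as ℤ
  import Data.Integer.Properties as ℤ
  open import Data.Integer.Tactic.RingSolver using (solve-∀)
  import Data.Nat.Coprimality as Coprime

  ℕtoℚ≡mkℚ : ∀ m → ℕtoℚ m ≡ mkℚ (+ m) 0 (Coprime.sym (Coprime.1-coprimeTo m))
  ℕtoℚ≡mkℚ m = normalize-coprime _

  ℕtoℚ-homo-+ : ∀ m n → ℕtoℚ (m ℕ.+ n) ≡ ℕtoℚ m + ℕtoℚ n
  ℕtoℚ-homo-+ m n = toℚᵘ-injective (ℚᵘ.≃-trans ≃-+ (ℚᵘ.≃-sym (toℚᵘ-homo-+ (ℕtoℚ m) (ℕtoℚ n))))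
    where
    regroup : ∀ (x y : ℤ.ℤ) → (x ℤ.+ y) ℤ.* + 1 ≡ (x ℤ.* + 1 ℤ.+ y ℤ.* + 1) ℤ.* + 1
    regroup = solve-∀
    ≃-+ : toℚᵘ (ℕtoℚ (m ℕ.+ n)) ℚᵘ.≃ toℚᵘ (ℕtoℚ m) ℚᵘ.+ toℚᵘ (ℕtoℚ n)
    ≃-+ rewrite ℕtoℚ≡mkℚ (m ℕ.+ n) | ℕtoℚ≡mkℚ m | ℕtoℚ≡mkℚ n =
      ℚᵘ.*≡* (trans (cong (ℤ._* + 1) (ℤ.pos-+ m n)) (regroup (+ m) (+ n)))

  ℕtoℚ-homo-* : ∀ m n → ℕtoℚ (m ℕ.* n) ≡ ℕtoℚ m * ℕtoℚ n
  ℕtoℚ-homo-* m n = toℚᵘ-injective (ℚᵘ.≃-trans ≃-* (ℚᵘ.≃-sym (toℚᵘ-homo-* (ℕtoℚ m) (ℕtoℚ n))))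
    where
    ≃-* : toℚᵘ (ℕtoℚ (m ℕ.* n)) ℚᵘ.≃ toℚᵘ (ℕtoℚ m) ℚᵘ.* toℚᵘ (ℕtoℚ n)
    ≃-* rewrite ℕtoℚ≡mkℚ (m ℕ.* n) | ℕtoℚ≡mkℚ m | ℕtoℚ≡mkℚ n =
      ℚᵘ.*≡* (cong (ℤ._* + 1) (ℤ.pos-* m n))

  ℕtoℚ-mono-≤ : ∀ {m n} → m ℕ.≤ n → ℕtoℚ m ≤ ℕtoℚ n
  ℕtoℚ-mono-≤ {m} {n} m≤n rewrite ℕtoℚ≡mkℚ m | ℕtoℚ≡mkℚ n =
    *≤* (subst₂ ℤ._≤_ (≡.sym (ℤ.*-identityʳ (+ m))) (≡.sym (ℤ.*-identityʳ (+ n))) (ℤ.+≤+ m≤n))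

  ℕtoℚ-mono-< : ∀ {m n} → m ℕ.< n → ℕtoℚ m < ℕtoℚ n
  ℕtoℚ-mono-< {m} {n} m<n rewrite ℕtoℚ≡mkℚ m | ℕtoℚ≡mkℚ n =
    *<* (subst₂ ℤ._<_ (≡.sym (ℤ.*-identityʳ (+ m))) (≡.sym (ℤ.*-identityʳ (+ n))) (ℤ.+<+ m<n))

  ℕtoℚ-cancel-≤ : ∀ {m n} → ℕtoℚ m ≤ ℕtoℚ n → m ℕ.≤ n
  ℕtoℚ-cancel-≤ {m} {n} m≤n rewrite ℕtoℚ≡mkℚ m | ℕtoℚ≡mkℚ n =
    ℤ.drop‿+≤+ (subst₂ ℤ._≤_ (ℤ.*-identityʳ (+ m)) (ℤ.*-identityʳ (+ n)) (drop-*≤* m≤n))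

  0≤ℕtoℚ : ∀ m → 0ℚ ≤ ℕtoℚ m
  0≤ℕtoℚ m = ℕtoℚ-mono-≤ {0} {m} ℕ.z≤n

  ℕtoℚ-homo-sum : ∀ {n} (f : Fin n → ℕ) → ℕtoℚ (sumℕ f) ≡ sumℚ (ℕtoℚ ∘ f)
  ℕtoℚ-homo-sum {zero}  f = refl
  ℕtoℚ-homo-sum {suc n} f =
    trans (ℕtoℚ-homo-+ (f Fin.zero) _) (cong (_+_ (ℕtoℚ (f Fin.zero))) (ℕtoℚ-homo-sum (f ∘ Fin.suc)))

  sumℚ-mono-≤ : ∀ {n} (f g : Fin n → ℚ) → (∀ i → f i ≤ g i) → sumℚ f ≤ sumℚ g
  sumℚ-mono-≤ {zero}  f g f≤g = ≤-refl
  sumℚ-mono-≤ {suc n} f g f≤g =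
    +-mono-≤ (f≤g Fin.zero) (sumℚ-mono-≤ (f ∘ Fin.suc) (g ∘ Fin.suc) (f≤g ∘ Fin.suc))

  sumℚ-cong : ∀ {n} {f g : Fin n → ℚ} → (∀ i → f i ≡ g i) → sumℚ f ≡ sumℚ g
  sumℚ-cong {zero}  f≡g = refl
  sumℚ-cong {suc n} f≡g = cong₂ _+_ (f≡g Fin.zero) (sumℚ-cong (f≡g ∘ Fin.suc))

  sumℚ-*ˡ : ∀ {n} r (f : Fin n → ℚ) → r * sumℚ f ≡ sumℚ (λ i → r * f i)
  sumℚ-*ˡ {zero}  r f = *-zeroʳ r
  sumℚ-*ˡ {suc n} r f =
    trans (*-distribˡ-+ r (f Fin.zero) _) (cong (_+_ (r * f Fin.zero)) (sumℚ-*ˡ r (f ∘ Fin.suc)))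

  p≤∣p∣ : ∀ p → p ≤ ∣ p ∣
  p≤∣p∣ (mkℚ (+ _)      _ _) = ≤-refl
  p≤∣p∣ (mkℚ ℤ.-[1+ _ ] _ _) = *≤* ℤ.-≤+

  *-monoˡ-≤-0≤ : ∀ r {p q} → 0ℚ ≤ r → p ≤ q → r * p ≤ r * q
  *-monoˡ-≤-0≤ r 0≤r = *-monoˡ-≤-nonNeg r {{nonNegative 0≤r}}

  *-monoʳ-≤-0≤ : ∀ r {p q} → 0ℚ ≤ r → p ≤ q → p * r ≤ q * r
  *-monoʳ-≤-0≤ r 0≤r = *-monoʳ-≤-nonNeg r {{nonNegative 0≤r}}

  scale : ℕ → ℚ
  scale s = ℕtoℚ (2 ℕ.^ s)

  scale-pos : ∀ s → 0ℚ < scale s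
  scale-pos s = ℕtoℚ-mono-< (ℕ.m^n>0 2 s)

  scale-cancel-≤ : ∀ s {p q} → scale s * p ≤ scale s * q → p ≤ q
  scale-cancel-≤ s = *-cancelˡ-≤-pos (scale s) {{positive (scale-pos s)}}

  scale-cancel-≡ : ∀ s {p q} → scale s * p ≡ scale s * q → p ≡ q
  scale-cancel-≡ s eq = ≤-antisym (scale-cancel-≤ s (≤-reflexive eq)) (scale-cancel-≤ s (≤-reflexive (≡.sym eq)))

  ℕtoℚ-*-/ : ∀ x d .{{_ : ℕ.NonZero d}} → ℕtoℚ d * ((+ x) / d) ≡ ℕtoℚ x
  ℕtoℚ-*-/ x d = go ((+ x) / d) (↥-/ (+ x) d) (↧-/ (+ x) d)
    where
    go : ∀ q {g} → ↥ q ℤ.* g ≡ + x → ↧ q ℤ.* g ≡ + d → ℕtoℚ d * q ≡ ℕtoℚ x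
    go q@(mkℚ num den-1 _) {g} ↥q*g≡x ↧q*g≡d = toℚᵘ-injective (ℚᵘ.≃-trans (toℚᵘ-homo-* (ℕtoℚ d) q) ≃x)
      where
      cross : ∀ num g den → ((den ℤ.* g) ℤ.* num) ℤ.* + 1 ≡ (num ℤ.* g) ℤ.* (+ 1 ℤ.* den)
      cross = solve-∀
      ≃x : toℚᵘ (ℕtoℚ d) ℚᵘ.* toℚᵘ q ℚᵘ.≃ toℚᵘ (ℕtoℚ x)
      ≃x rewrite ℕtoℚ≡mkℚ d | ℕtoℚ≡mkℚ x = ℚᵘ.*≡*
        (subst₂ (λ X Y → (Y ℤ.* num) ℤ.* + 1 ≡ X ℤ.* (+ 1 ℤ.* ↧ q)) ↥q*g≡x ↧q*g≡d (cross num g (↧ q)))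

  scale-*-dyadic : ∀ s x → scale s * dyadic s x ≡ ℕtoℚ x
  scale-*-dyadic s x = ℕtoℚ-*-/ x (2 ℕ.^ s) {{ℕ.m^n≢0 2 s}}

  dyadic-*2^ : ∀ s m → dyadic s (m ℕ.* 2 ℕ.^ s) ≡ ℕtoℚ m
  dyadic-*2^ s m = scale-cancel-≡ s (begin
    scale s * dyadic s (m ℕ.* 2 ℕ.^ s)  ≡⟨ scale-*-dyadic s (m ℕ.* 2 ℕ.^ s) ⟩
    ℕtoℚ (m ℕ.* 2 ℕ.^ s)                ≡⟨ ℕtoℚ-homo-* m (2 ℕ.^ s) ⟩
    ℕtoℚ m * scale s                    ≡⟨ *-comm (ℕtoℚ m) (scale s) ⟩
    scale s * ℕtoℚ m                    ∎)
    where open ≡-Reasoning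

  scale-*-sumAt-dyadic : ∀ {n} (G : SimpleGraph n) s (X : Fin n → Fin n → ℕ) u →
    scale s * sumAt G (λ x y → dyadic s (X x y)) u
      ≡ ℕtoℚ (sumℕ (λ v → if Adj G u v then X u v else 0))
  scale-*-sumAt-dyadic {n} G s X u =
    trans (sumℚ-*ˡ {n} (scale s) _) (trans (sumℚ-cong termwise) (≡.sym (ℕtoℚ-homo-sum {n} _)))
    where
    termwise : ∀ v → scale s * (if Adj G u v then dyadic s (X u v) else 0ℚ)
                   ≡ ℕtoℚ (if Adj G u v then X u v else 0)
    termwise v with Adj G u v
    ... | true  = scale-*-dyadic s (X u v)
    ... | false = *-zeroʳ (scale s)

  2^ℚ≡scale : ∀ L → ℕtoℚ 2 ^ℚ L ≡ scale L
  2^ℚ≡scale zero    = refl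
  2^ℚ≡scale (suc L) = trans (cong (ℕtoℚ 2 *_) (2^ℚ≡scale L)) (≡.sym (ℕtoℚ-homo-* 2 (2 ℕ.^ L)))

  ℕtoℚ-homo-+-* : ∀ x y z → ℕtoℚ (x ℕ.+ y ℕ.* z) ≡ ℕtoℚ x + ℕtoℚ y * ℕtoℚ z
  ℕtoℚ-homo-+-* x y z = trans (ℕtoℚ-homo-+ x (y ℕ.* z)) (cong (_+_ (ℕtoℚ x)) (ℕtoℚ-homo-* y z))

  scale-nonNeg : ∀ s → 0ℚ ≤ scale s
  scale-nonNeg s = <⇒≤ (scale-pos s)

  scale-+ : ∀ r s → scale (r ℕ.+ s) ≡ scale r * scale s
  scale-+ r s = trans (cong ℕtoℚ (ℕ.^-distribˡ-+-* 2 r s)) (ℕtoℚ-homo-* (2 ℕ.^ r) (2 ℕ.^ s))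

  1≤dyadic+dyadic⇒2^s≤+ : ∀ s x y → 1ℚ ≤ dyadic s x + dyadic s y → 2 ℕ.^ s ℕ.≤ x ℕ.+ y
  1≤dyadic+dyadic⇒2^s≤+ s x y 1≤ = ℕtoℚ-cancel-≤ (begin
    scale s                              ≡⟨ *-identityʳ (scale s) ⟨
    scale s * 1ℚ                         ≤⟨ *-monoˡ-≤-0≤ (scale s) (scale-nonNeg s) 1≤ ⟩
    scale s * (dyadic s x + dyadic s y)  ≡⟨ *-distribˡ-+ (scale s) (dyadic s x) (dyadic s y) ⟩
    scale s * dyadic s x + scale s * dyadic s y
                                         ≡⟨ cong₂ _+_ (scale-*-dyadic s x) (scale-*-dyadic s y) ⟩
    ℕtoℚ x + ℕtoℚ y                      ≡⟨ ℕtoℚ-homo-+ x y ⟨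
    ℕtoℚ (x ℕ.+ y)                       ∎)
    where open ≤-Reasoning

  ℕtoℚ-suc-⊓-1 : ∀ m → ℕtoℚ (suc m) ℚ.⊓ 1ℚ ≡ 1ℚ
  ℕtoℚ-suc-⊓-1 m = p≥q⇒p⊓q≡q (ℕtoℚ-mono-≤ {1} {suc m} (ℕ.s≤s ℕ.z≤n))

  ℕtoℚ-⊓-1∈01 : ∀ m → ℕtoℚ m ℚ.⊓ 1ℚ ≡ 0ℚ ⊎ ℕtoℚ m ℚ.⊓ 1ℚ ≡ 1ℚ
  ℕtoℚ-⊓-1∈01 zero    = inj₁ refl
  ℕtoℚ-⊓-1∈01 (suc m) = inj₂ (ℕtoℚ-suc-⊓-1 m)

  ℕtoℚ-⊓-1-covers : ∀ m m′ → 1 ℕ.≤ m ℕ.+ m′ → 1ℚ ≤ ℕtoℚ m ℚ.⊓ 1ℚ + ℕtoℚ m′ ℚ.⊓ 1ℚ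
  ℕtoℚ-⊓-1-covers zero    (suc m′) _ rewrite ℕtoℚ-suc-⊓-1 m′ = ≤-refl
  ℕtoℚ-⊓-1-covers (suc m) m′       _ rewrite ℕtoℚ-suc-⊓-1 m with ℕtoℚ-⊓-1∈01 m′
  ... | inj₁ ≡0 rewrite ≡0 = ≤-refl
  ... | inj₂ ≡1 rewrite ≡1 = ℕtoℚ-mono-≤ {1} {2} (ℕ.s≤s ℕ.z≤n)

  if-then-0-mono-≤ : ∀ b {p q} → p ≤ q → (if b then p else 0ℚ) ≤ (if b then q else 0ℚ)
  if-then-0-mono-≤ true  p≤q = p≤q
  if-then-0-mono-≤ false _   = ≤-refl

  1≤1+p : ∀ {p} → 0ℚ ≤ p → 1ℚ ≤ 1ℚ + p
  1≤1+p {p} 0≤p = subst (_≤ 1ℚ + p) (+-identityʳ 1ℚ) (+-monoʳ-≤ 1ℚ 0≤p)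

  0≤1+p : ∀ {p} → 0ℚ ≤ p → 0ℚ ≤ 1ℚ + p
  0≤1+p 0≤p = ≤-trans (0≤ℕtoℚ 1) (1≤1+p 0≤p)

  1≤p*q : ∀ {p q} → 1ℚ ≤ p → 1ℚ ≤ q → 1ℚ ≤ p * q
  1≤p*q {p} {q} 1≤p 1≤q = begin
    1ℚ      ≤⟨ 1≤p ⟩
    p       ≡⟨ *-identityʳ p ⟨
    p * 1ℚ  ≤⟨ *-monoˡ-≤-0≤ p (≤-trans (0≤ℕtoℚ 1) 1≤p) 1≤q ⟩
    p * q   ∎
    where open ≤-Reasoning

  *-nonNeg : ∀ {p q} → 0ℚ ≤ p → 0ℚ ≤ q → 0ℚ ≤ p * q
  *-nonNeg {p} 0≤p 0≤q = ≤-trans (≤-reflexive (≡.sym (*-zeroʳ p))) (*-monoˡ-≤-0≤ p 0≤p 0≤q)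

  ^ℚ-nonNeg : ∀ {p} → 0ℚ ≤ p → ∀ k → 0ℚ ≤ p ^ℚ k
  ^ℚ-nonNeg 0≤p zero    = 0≤ℕtoℚ 1
  ^ℚ-nonNeg 0≤p (suc k) = *-nonNeg 0≤p (^ℚ-nonNeg 0≤p k)

  one-round-growth : ∀ {ℓ′ ℓ w out inn d e c : ℚ} → 0ℚ ≤ w → 0ℚ ≤ e →
    ℓ′ + w * inn ≤ ℓ + w * out → w * d ≤ ℓ → ∣ out - inn ∣ ≤ e * d + c →
    ℓ′ ≤ (1ℚ + e) * ℓ + c * w
  one-round-growth {ℓ′} {ℓ} {w} {out} {inn} {d} {e} {c} 0≤w 0≤e moved wd≤ℓ balanced = begin
    ℓ′                       ≡⟨ solve 3 (λ ℓ′ w i → ℓ′ := ℓ′ :+ w :* i :- w :* i) refl ℓ′ w inn ⟩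
    ℓ′ + w * inn - w * inn   ≤⟨ +-monoˡ-≤ (- (w * inn)) moved ⟩
    ℓ + w * out - w * inn    ≡⟨ solve 4 (λ ℓ w o i → ℓ :+ w :* o :- w :* i := ℓ :+ w :* (o :- i)) refl ℓ w out inn ⟩
    ℓ + w * (out - inn)      ≤⟨ +-monoʳ-≤ ℓ (*-monoˡ-≤-0≤ w 0≤w (≤-trans (p≤∣p∣ (out - inn)) balanced)) ⟩
    ℓ + w * (e * d + c)      ≡⟨ solve 5 (λ ℓ w e d c → ℓ :+ w :* (e :* d :+ c) := ℓ :+ e :* (w :* d) :+ c :* w)
                                   refl ℓ w e d c ⟩
    ℓ + e * (w * d) + c * w  ≤⟨ +-monoˡ-≤ (c * w) (+-monoʳ-≤ ℓ (*-monoˡ-≤-0≤ e 0≤e wd≤ℓ)) ⟩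
    ℓ + e * ℓ + c * w        ≡⟨ solve 3 (λ ℓ e x → ℓ :+ e :* ℓ :+ x := (con 1ℚ :+ e) :* ℓ :+ x) refl ℓ e (c * w) ⟩
    (1ℚ + e) * ℓ + c * w     ∎
    where open ≤-Reasoning

  16[1+e]+12≤16*2 : ∀ {e} → e ≤ + 1 / 4 → ℕtoℚ 16 * (1ℚ + e) + ℕtoℚ 12 ≤ ℕtoℚ 16 * ℕtoℚ 2
  16[1+e]+12≤16*2 {e} e≤¼ = begin
    ℕtoℚ 16 * (1ℚ + e) + ℕtoℚ 12
      ≡⟨ solve 3 (λ k e c → k :* (con 1ℚ :+ e) :+ c := k :* e :+ (k :+ c)) refl (ℕtoℚ 16) e (ℕtoℚ 12) ⟩
    ℕtoℚ 16 * e + (ℕtoℚ 16 + ℕtoℚ 12)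
      ≤⟨ +-monoˡ-≤ (ℕtoℚ 16 + ℕtoℚ 12) (*-monoˡ-≤-0≤ (ℕtoℚ 16) (0≤ℕtoℚ 16) e≤¼) ⟩
    ℕtoℚ 16 * (+ 1 / 4) + (ℕtoℚ 16 + ℕtoℚ 12)  ≡⟨⟩
    ℕtoℚ 16 * ℕtoℚ 2                        ∎
    where open ≤-Reasoning

  -- 16 is the least c with c (1 + 1/4) + 12 ≤ 2 c.
  geometric-growth : ∀ {e} → 0ℚ ≤ e → e ≤ + 1 / 4 → (x : ℕ → ℚ) (t : ℕ) →
    (∀ j → j ℕ.< t → x (suc j) ≤ (1ℚ + e) * x j + ℕtoℚ 12 * scale j) →
    ∀ k → k ℕ.≤ t → x k ≤ (1ℚ + e) ^ℚ k * x 0 + ℕtoℚ 16 * scale k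
  geometric-growth 0≤e e≤¼ x t step zero _ = begin
    x 0                          ≡⟨ solve 1 (λ y → y := con 1ℚ :* y :+ con 0ℚ) refl (x 0) ⟩
    1ℚ * x 0 + 0ℚ                ≤⟨ +-monoʳ-≤ (1ℚ * x 0) (0≤ℕtoℚ 16) ⟩
    1ℚ * x 0 + ℕtoℚ 16 * scale 0 ∎
    where open ≤-Reasoning
  geometric-growth {e} 0≤e e≤¼ x t step (suc j) j<t = begin
    x (suc j)
      ≤⟨ step j j<t ⟩
    (1ℚ + e) * x j + k12 * w
      ≤⟨ +-monoˡ-≤ (k12 * w) (*-monoˡ-≤-0≤ (1ℚ + e) (0≤1+p 0≤e)
           (geometric-growth 0≤e e≤¼ x t step j (ℕ.<⇒≤ j<t))) ⟩
    (1ℚ + e) * (P * x 0 + k16 * w) + k12 * w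
      ≡⟨ solve 6 (λ e P x₀ k16 w k12 → (con 1ℚ :+ e) :* (P :* x₀ :+ k16 :* w) :+ k12 :* w
                    := (con 1ℚ :+ e) :* P :* x₀ :+ (k16 :* (con 1ℚ :+ e) :+ k12) :* w)
           refl e P (x 0) k16 w k12 ⟩
    (1ℚ + e) * P * x 0 + (k16 * (1ℚ + e) + k12) * w
      ≤⟨ +-monoʳ-≤ ((1ℚ + e) * P * x 0) (*-monoʳ-≤-0≤ w (scale-nonNeg j) (16[1+e]+12≤16*2 e≤¼)) ⟩
    (1ℚ + e) * P * x 0 + (k16 * ℕtoℚ 2) * w
      ≡⟨ cong (_+_ ((1ℚ + e) * P * x 0)) (*-assoc k16 (ℕtoℚ 2) w) ⟩
    (1ℚ + e) * P * x 0 + k16 * (ℕtoℚ 2 * w)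
      ≡⟨ cong (λ y → (1ℚ + e) * P * x 0 + k16 * y) (ℕtoℚ-homo-* 2 (2 ℕ.^ j)) ⟨
    (1ℚ + e) * P * x 0 + k16 * scale (suc j)
      ∎
    where
    open ≤-Reasoning
    k12 = ℕtoℚ 12
    k16 = ℕtoℚ 16
    w = scale j
    P = (1ℚ + e) ^ℚ j

-- The output

module Output {n} (G : SimpleGraph n) (B t : ℕ) (a : Fin n → Fin n → ℕ)
              (orient : ℕ → Fin n → Fin n → Bool) where
  open Run G B t a orient public
  open import Data.Rational
  open import Data.Rational.Properties
  open import Data.Rational.Solver using (module +-*-Solver)
  open +-*-Solver

  α : Fin n → Fin n → ℚ
  α = output B t G a orient

  -- After t rounds no fractional bits remain: α⁽ᵗ⁾ u v is the integer α^{(t)}_{eu}.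
  α⁽ᵗ⁾ : Fin n → Fin n → ℕ
  α⁽ᵗ⁾ u v = _∣_.quotient (2^k∣A t u v)

  A≡α⁽ᵗ⁾*2^t : ∀ u v → A t u v ≡ α⁽ᵗ⁾ u v ℕ.* 2 ℕ.^ t
  A≡α⁽ᵗ⁾*2^t u v = _∣_.equality (2^k∣A t u v)

  α≡α⁽ᵗ⁾⊓1 : ∀ u v → α u v ≡ ℕtoℚ (α⁽ᵗ⁾ u v) ℚ.⊓ 1ℚ
  α≡α⁽ᵗ⁾⊓1 u v = cong (ℚ._⊓ 1ℚ) (trans (cong (dyadic t) (A≡α⁽ᵗ⁾*2^t u v)) (dyadic-*2^ t (α⁽ᵗ⁾ u v)))

  α∈01 : ∀ u v → α u v ≡ 0ℚ ⊎ α u v ≡ 1ℚ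
  α∈01 u v = subst (λ x → x ≡ 0ℚ ⊎ x ≡ 1ℚ) (≡.sym (α≡α⁽ᵗ⁾⊓1 u v)) (ℕtoℚ-⊓-1∈01 (α⁽ᵗ⁾ u v))

  α-covers : t ℕ.≤ B → (∀ j → j ℕ.< t → IsOrientation (E j) (o j)) →
    (∀ u v → Adj G u v ≡ true → 1ℚ ≤ dyadic B (a u v) + dyadic B (a v u)) →
    ∀ u v → Adj G u v ≡ true → 1ℚ ≤ α u v + α v u
  α-covers t≤B ori cover u v adj =
    subst₂ (λ x y → 1ℚ ≤ x + y) (≡.sym (α≡α⁽ᵗ⁾⊓1 u v)) (≡.sym (α≡α⁽ᵗ⁾⊓1 v u))
      (ℕtoℚ-⊓-1-covers m m′ 1≤m+m′)
    where
    open ℕ.≤-Reasoning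
    m = α⁽ᵗ⁾ u v
    m′ = α⁽ᵗ⁾ v u
    input-cover : ∀ u v → Adj G u v ≡ true → 2 ℕ.^ B ℕ.≤ a u v ℕ.+ a v u
    input-cover u v adj = 1≤dyadic+dyadic⇒2^s≤+ B (a u v) (a v u) (cover u v adj)
    1≤m+m′ : 1 ℕ.≤ m ℕ.+ m′
    1≤m+m′ = ℕ.*-cancelʳ-≤ 1 (m ℕ.+ m′) (2 ℕ.^ t) {{ℕ.m^n≢0 2 t}} (begin
      1 ℕ.* 2 ℕ.^ t                      ≡⟨ ℕ.*-identityˡ (2 ℕ.^ t) ⟩
      2 ℕ.^ t                            ≤⟨ edge-sum t≤B ori input-cover t ℕ.≤-refl u v adj ⟩
      A t u v ℕ.+ A t v u                ≡⟨ cong₂ ℕ._+_ (A≡α⁽ᵗ⁾*2^t u v) (A≡α⁽ᵗ⁾*2^t v u) ⟩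
      m ℕ.* 2 ℕ.^ t ℕ.+ m′ ℕ.* 2 ℕ.^ t   ≡⟨ ℕ.*-distribʳ-+ (2 ℕ.^ t) m m′ ⟨
      (m ℕ.+ m′) ℕ.* 2 ℕ.^ t             ∎)

  loadℚ : ℕ → Fin n → ℚ
  loadℚ k u = ℕtoℚ (load k u)

  load-growth : ∀ {ε₃} → 0ℚ ≤ ε₃ → ∀ j → IsOrientation (E j) (o j) → Balanced ε₃ (E j) (o j) →
    ∀ u → loadℚ (suc j) u ≤ (1ℚ + ε₃) * loadℚ j u + ℕtoℚ 12 * scale j
  load-growth 0≤ε₃ j ori balanced u =
    one-round-growth (scale-nonNeg j) 0≤ε₃ moved degE≤loadℚ (balanced u)
    where
    moved : loadℚ (suc j) u + scale j * ℕtoℚ (indeg (E j) (o j) u)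
          ≤ loadℚ j u + scale j * ℕtoℚ (outdeg (E j) (o j) u)
    moved = subst₂ _≤_ (ℕtoℚ-homo-+-* (load (suc j) u) (2 ℕ.^ j) (indeg (E j) (o j) u))
                       (ℕtoℚ-homo-+-* (load j u) (2 ℕ.^ j) (outdeg (E j) (o j) u))
                       (ℕtoℚ-mono-≤ (load-step j ori u))
    degE≤loadℚ : scale j * ℕtoℚ (degE (E j) u) ≤ loadℚ j u
    degE≤loadℚ = subst (_≤ loadℚ j u) (ℕtoℚ-homo-* (2 ℕ.^ j) (degE (E j) u))
                       (ℕtoℚ-mono-≤ (2^j*degE≤load j u))

  -- Without rounding (t = B) the initial load is the input load; otherwise t = L and the
  -- ceiling adds at most deg u ≤ ε₂ 2^L per vertex.
  initial-load : ∀ {ε₂ X : ℚ} {L} → t ≡ B ℕ.⊓ L → 1ℚ ≤ X → 0ℚ ≤ ε₂ →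
    ℕtoℚ (maxDeg G) ≤ ε₂ * (ℕtoℚ 2 ^ℚ L) →
    ∀ u → sumAt G (λ x y → dyadic B (a x y)) u ≤ X → loadℚ 0 u ≤ scale t * ((1ℚ + ε₂) * X)
  initial-load {ε₂} {X} {L} t≡B⊓L 1≤X 0≤ε₂ Δ≤ u input≤X =
    [ when-B≤L , when-L≤B ]′ (ℕ.≤-total B L)
    where
    open ≤-Reasoning
    input≤ : ℕtoℚ (inputLoad u) ≤ scale B * X
    input≤ = subst (_≤ scale B * X) (scale-*-sumAt-dyadic G B a u)
                   (*-monoˡ-≤-0≤ (scale B) (scale-nonNeg B) input≤X)

    when-B≤L : B ℕ.≤ L → loadℚ 0 u ≤ scale t * ((1ℚ + ε₂) * X)
    when-B≤L B≤L = begin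
      loadℚ 0 u                   ≡⟨ cong ℕtoℚ (load₀≡inputLoad t≡B u) ⟩
      ℕtoℚ (inputLoad u)          ≤⟨ input≤ ⟩
      scale B * X                 ≡⟨ cong (λ s → scale s * X) t≡B ⟨
      scale t * X                 ≡⟨ cong (scale t *_) (*-identityˡ X) ⟨
      scale t * (1ℚ * X)          ≤⟨ *-monoˡ-≤-0≤ (scale t) (scale-nonNeg t)
                                       (*-monoʳ-≤-0≤ X (≤-trans (0≤ℕtoℚ 1) 1≤X) (1≤1+p 0≤ε₂)) ⟩
      scale t * ((1ℚ + ε₂) * X)   ∎
      where
      t≡B = trans t≡B⊓L (ℕ.m≤n⇒m⊓n≡m B≤L)

    when-L≤B : L ℕ.≤ B → loadℚ 0 u ≤ scale t * ((1ℚ + ε₂) * X)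
    when-L≤B L≤B = scale-cancel-≤ s (begin
      scale s * loadℚ 0 u
        ≡⟨ ℕtoℚ-homo-* (2 ℕ.^ s) (load 0 u) ⟨
      ℕtoℚ (2 ℕ.^ s ℕ.* load 0 u)
        ≤⟨ ℕtoℚ-mono-≤ (load₀-bound u) ⟩
      ℕtoℚ (inputLoad u ℕ.+ 2 ℕ.^ s ℕ.* deg G u)
        ≡⟨ ℕtoℚ-homo-+-* (inputLoad u) (2 ℕ.^ s) (deg G u) ⟩
      ℕtoℚ (inputLoad u) + scale s * d
        ≤⟨ +-monoˡ-≤ (scale s * d) input≤ ⟩
      scale B * X + scale s * d
        ≡⟨ cong (λ r → scale r * X + scale s * d) (ℕ.m∸n+n≡m t≤B) ⟨
      scale (s ℕ.+ t) * X + scale s * d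
        ≡⟨ cong (λ r → r * X + scale s * d) (scale-+ s t) ⟩
      scale s * scale t * X + scale s * d
        ≡⟨ solve 4 (λ σ τ x d → σ :* τ :* x :+ σ :* d := σ :* (τ :* x :+ d)) refl (scale s) (scale t) X d ⟩
      scale s * (scale t * X + d)
        ≤⟨ *-monoˡ-≤-0≤ (scale s) (scale-nonNeg s) (+-monoʳ-≤ (scale t * X) d≤) ⟩
      scale s * (scale t * X + ε₂ * scale t * X)
        ≡⟨ cong (scale s *_) (solve 3 (λ τ x e → τ :* x :+ e :* τ :* x := τ :* ((con 1ℚ :+ e) :* x))
                                refl (scale t) X ε₂) ⟩
      scale s * (scale t * ((1ℚ + ε₂) * X))
        ∎)
      where
      s = B ∸ t
      d = ℕtoℚ (deg G u)
      t≤B = subst (ℕ._≤ B) (≡.sym t≡B⊓L) (ℕ.m⊓n≤m B L)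
      t≡L = trans t≡B⊓L (ℕ.m≥n⇒m⊓n≡n L≤B)
      d≤ : d ≤ ε₂ * scale t * X
      d≤ = begin
        d                     ≤⟨ ℕtoℚ-mono-≤ (maxℕ-upper (deg G) u) ⟩
        ℕtoℚ (maxDeg G)       ≤⟨ Δ≤ ⟩
        ε₂ * (ℕtoℚ 2 ^ℚ L)    ≡⟨ cong (ε₂ *_) (trans (2^ℚ≡scale L) (cong scale (≡.sym t≡L))) ⟩
        ε₂ * scale t          ≡⟨ *-identityʳ (ε₂ * scale t) ⟨
        ε₂ * scale t * 1ℚ     ≤⟨ *-monoˡ-≤-0≤ (ε₂ * scale t) (*-nonNeg 0≤ε₂ (scale-nonNeg t)) 1≤X ⟩
        ε₂ * scale t * X      ∎

  α-load : ∀ {ε₁ ε₂ ε₃ : ℚ} {D̃ L} → t ≡ B ℕ.⊓ L → 1 ℕ.≤ D̃ →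
    0ℚ ≤ ε₁ → 0ℚ ≤ ε₂ → 0ℚ ≤ ε₃ → ε₃ ≤ + 1 / 4 →
    ℕtoℚ (maxDeg G) ≤ ε₂ * (ℕtoℚ 2 ^ℚ L) →
    (∀ j → j ℕ.< t → IsOrientation (E j) (o j) × Balanced ε₃ (E j) (o j)) →
    ∀ u → sumAt G (λ x y → dyadic B (a x y)) u ≤ (1ℚ + ε₁) * ℕtoℚ D̃ →
    sumAt G α u ≤ (1ℚ + ε₁) * (1ℚ + ε₂) * ((1ℚ + ε₃) ^ℚ t) * ℕtoℚ D̃ + ℕtoℚ 16
  α-load {ε₁} {ε₂} {ε₃} {D̃} t≡B⊓L 1≤D̃ 0≤ε₁ 0≤ε₂ 0≤ε₃ ε₃≤¼ Δ≤ rounds u input≤ =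
    scale-cancel-≤ t (begin
      scale t * sumAt G α u
        ≤⟨ *-monoˡ-≤-0≤ (scale t) (scale-nonNeg t)
             (sumℚ-mono-≤ _ _ λ v → if-then-0-mono-≤ (Adj G u v) (p⊓q≤p _ _)) ⟩
      scale t * sumAt G (λ x y → dyadic t (A t x y)) u
        ≡⟨ scale-*-sumAt-dyadic G t (A t) u ⟩
      loadℚ t u
        ≤⟨ geometric-growth 0≤ε₃ ε₃≤¼ (λ k → loadℚ k u) t growth t ℕ.≤-refl ⟩
      P * loadℚ 0 u + ℕtoℚ 16 * scale t
        ≤⟨ +-monoˡ-≤ (ℕtoℚ 16 * scale t) (*-monoˡ-≤-0≤ P (^ℚ-nonNeg (0≤1+p 0≤ε₃) t)
             (initial-load t≡B⊓L 1≤X 0≤ε₂ Δ≤ u input≤)) ⟩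
      P * (scale t * ((1ℚ + ε₂) * X)) + ℕtoℚ 16 * scale t
        ≡⟨ solve 6 (λ P τ e₁ e₂ D k → P :* (τ :* ((con 1ℚ :+ e₂) :* ((con 1ℚ :+ e₁) :* D))) :+ k :* τ
                      := τ :* ((con 1ℚ :+ e₁) :* (con 1ℚ :+ e₂) :* P :* D :+ k))
             refl P (scale t) ε₁ ε₂ (ℕtoℚ D̃) (ℕtoℚ 16) ⟩
      scale t * ((1ℚ + ε₁) * (1ℚ + ε₂) * P * ℕtoℚ D̃ + ℕtoℚ 16)
        ∎)
    where
    open ≤-Reasoning
    X = (1ℚ + ε₁) * ℕtoℚ D̃
    1≤X : 1ℚ ≤ X
    1≤X = 1≤p*q (1≤1+p 0≤ε₁) (ℕtoℚ-mono-≤ 1≤D̃)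
    P = (1ℚ + ε₃) ^ℚ t
    growth : ∀ j → j ℕ.< t → loadℚ (suc j) u ≤ (1ℚ + ε₃) * loadℚ j u + ℕtoℚ 12 * scale j
    growth j j<t = load-growth 0≤ε₃ j (proj₁ (rounds j j<t)) (proj₂ (rounds j j<t)) u

lemma13 : (n : ℕ) (G : SimpleGraph n) (D̃ : ℕ) (ε₁ ε₂ ε₃ : ℚ) (B : ℕ)
    (a : Fin n → Fin n → ℕ) (L t : ℕ) (orient : ℕ → Fin n → Fin n → Bool) →
    1 ℕ.≤ D̃ →
    0ℚ ℚ.< ε₁ → ε₁ ℚ.< 1ℚ → 0ℚ ℚ.< ε₂ → ε₂ ℚ.< 1ℚ → 0ℚ ℚ.< ε₃ → ε₃ ℚ.< 1ℚ →
    ε₃ ℚ.≤ (+ 1) ℚ./ 4 →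
    (∀ u v → Adj G u v ≡ true → 1ℚ ℚ.≤ dyadic B (a u v) ℚ.+ dyadic B (a v u)) →
    (∀ u → sumAt G (λ x y → dyadic B (a x y)) u
             ℚ.≤ (1ℚ ℚ.+ ε₁) ℚ.* ℕtoℚ D̃) →
    ℕtoℚ (maxDeg G) ℚ.≤ ε₂ ℚ.* (ℕtoℚ 2 ^ℚ L) →
    (∀ L′ → L′ ℕ.< L → ε₂ ℚ.* (ℕtoℚ 2 ^ℚ L′) ℚ.< ℕtoℚ (maxDeg G)) →
    t ≡ B ⊓ L →
    (∀ k → 1 ℕ.≤ k → k ℕ.≤ t →
       IsOrientation (Ek G k (runA B t G a orient (k ∸ 1))) (orient k)
       × Balanced ε₃ (Ek G k (runA B t G a orient (k ∸ 1))) (orient k)) →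
    ((∀ u v → Adj G u v ≡ true →
        output B t G a orient u v ≡ 0ℚ ⊎ output B t G a orient u v ≡ 1ℚ)
     × (∀ u v → Adj G u v ≡ true →
        1ℚ ℚ.≤ output B t G a orient u v ℚ.+ output B t G a orient v u)
     × (∀ u → sumAt G (output B t G a orient) u
        ℚ.≤ (1ℚ ℚ.+ ε₁) ℚ.* (1ℚ ℚ.+ ε₂) ℚ.* ((1ℚ ℚ.+ ε₃) ^ℚ t) ℚ.* ℕtoℚ D̃
            ℚ.+ ℕtoℚ 16))
lemma13 n G D̃ ε₁ ε₂ ε₃ B a L t orient 1≤D̃ 0<ε₁ _ 0<ε₂ _ 0<ε₃ _ ε₃≤¼ cover input≤ Δ≤ _ t≡B⊓L rounds =
    (λ u v _ → α∈01 u v)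
  , α-covers t≤B (λ j j<t → proj₁ (rounds′ j j<t)) cover
  , λ u → α-load t≡B⊓L 1≤D̃ (ℚ.<⇒≤ 0<ε₁) (ℚ.<⇒≤ 0<ε₂) (ℚ.<⇒≤ 0<ε₃) ε₃≤¼ Δ≤
                   rounds′ u (input≤ u)
  where
  open Output G B t a orient
  rounds′ : ∀ j → j ℕ.< t → IsOrientation (E j) (o j) × Balanced ε₃ (E j) (o j)
  rounds′ j = rounds (suc j) (ℕ.s≤s ℕ.z≤n)
  t≤B : t ℕ.≤ B
  t≤B = subst (ℕ._≤ B) (≡.sym t≡B⊓L) (ℕ.m⊓n≤m B L)
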